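{- Let $S$ be a countably infinite set. There are infinite sets $\Sigma, \Sigma' \subseteq \mathcal{P}(S)$ of moieties of $S$ satisfying: (i) for all finite $\mathcal{U}, \mathcal{W} \subseteq \Sigma$, finite $\mathcal{V} \subseteq \Sigma'$ and finite $C, D \subseteq S$ such that $C \cup \bigcup\mathcal{U} \subseteq \bigcap\mathcal{W}$ and $(C \cup \bigcup \mathcal{U}) \cap (D \cup \bigcup\mathcal{V}) = \varnothing$, there is $Z \in \Sigma$ with $C \cup \bigcup\mathcal{U} \subseteq Z \subseteq \bigcap \mathcal{W}$ and $Z \cap (D \cup \bigcup\mathcal{V}) = \varnothing$; and if moreover $\mathcal{U} \cap \mathcal{W} = \varnothing$, there are infinitely many such $Z$; (ii) for all finite $\mathcal{U}, \mathcal{W} \subseteq \Sigma'$, finite $\mathcal{V} \subseteq \Sigma$ and finite $C, D \subseteq S$ such that $C \cup \bigcup\mathcal{W} \subseteq \bigcap\mathcal{U}$ and $(C \cup \bigcup\mathcal{W}) \cap (D \cup \bigcup \mathcal{V}) = \varnothing$, there is $Z \in \Sigma'$ with $C \cup \bigcup\mathcal{W} \subseteq Z \subseteq \bigcap\mathcal{U}$ and $Z \cap (D \cup \bigcup\mathcal{V}) = \varnothing$; and if moreover $\mathcal{U} \cap \mathcal{W} = \varnothing$, there are infinitely many such $Z$.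
   Context: A subset $S' \subseteq S$ is a moiety of $S$ if both $S'$ and $S \setminus S'$ are infinite. Convention: for $\mathcal{T} \subseteq \mathcal{P}(S)$, $\bigcap \mathcal{T} = S$ when $\mathcal{T} = \varnothing$ (and $\bigcup\varnothing = \varnothing$). -}

module Defs where

open import Level using (0ℓ)
open import Data.Nat using (ℕ)
open import Data.List using (List; []; _∷_)
open import Data.List.Relation.Unary.All using (All)
open import Data.List.Membership.Propositional using (_∈_; _∉_)
open import Data.Product using (Σ; ∃; ∃-syntax; _×_; _,_)
open import Data.Empty using (⊥)
open import Relation.Nullary using (¬_)
open import Relation.Unary using (Pred; _∪_; _∩_; _⊆_; _≐_; ∁) renaming (∅ to ∅ₚ; U to Uₚ)
open import Function.Bundles using (_⤖_)

Subset : Set → Set₁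
Subset S = Pred S 0ℓ

Family : Set → Set₁
Family S = Pred (Subset S) 0ℓ

module _ {S : Set} where

  fromList : List S → Subset S
  fromList xs = λ x → x ∈ xs

  ⋃ : List (Subset S) → Subset S
  ⋃ []       = ∅ₚ
  ⋃ (A ∷ As) = A ∪ ⋃ As

  ⋂ : List (Subset S) → Subset S
  ⋂ []       = Uₚ
  ⋂ (A ∷ As) = A ∩ ⋂ As

  Disjoint : Subset S → Subset S → Set
  Disjoint A B = ∀ x → A x → B x → ⊥

  Infinite : Subset S → Set
  Infinite A = (xs : List S) → ∃[ x ] (A x × x ∉ xs)

  Moiety : Subset S → Set
  Moiety A = Infinite A × Infinite (∁ A)

  InfiniteFamily : Pred (Subset S) 0ℓ → Set₁
  InfiniteFamily Q = (Zs : List (Subset S)) → ∃[ Z ] (Q Z × All (λ Z' → ¬ (Z ≐ Z')) Zs)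

  -- a family respects extensional equality of subsets (it is a set of subsets)
  Extensional : Family S → Set₁
  Extensional Σ₀ = ∀ {A B : Subset S} → A ≐ B → Σ₀ A → Σ₀ B

  DisjointFamilies : List (Subset S) → List (Subset S) → Set₁
  DisjointFamilies Us Ws = All (λ A → All (λ B → ¬ (A ≐ B)) Ws) Us

  Cond-i : Family S → Family S → Set₁
  Cond-i Σ₁ Σ₂ =
    (U W V : List (Subset S)) (C D : List S) →
    All Σ₁ U → All Σ₁ W → All Σ₂ V →
    (fromList C ∪ ⋃ U) ⊆ ⋂ W →
    Disjoint (fromList C ∪ ⋃ U) (fromList D ∪ ⋃ V) →
    let Good : Pred (Subset S) 0ℓ
        Good Z = Σ₁ Z × ((fromList C ∪ ⋃ U) ⊆ Z) × (Z ⊆ ⋂ W)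
                 × Disjoint Z (fromList D ∪ ⋃ V)
    in (∃[ Z ] Good Z) × (DisjointFamilies U W → InfiniteFamily Good)

  -- Condition (ii), written out with the paper's roles of U and W
  Cond-ii : Family S → Family S → Set₁
  Cond-ii Σ₁ Σ₂ =
    (U W V : List (Subset S)) (C D : List S) →
    All Σ₂ U → All Σ₂ W → All Σ₁ V →
    (fromList C ∪ ⋃ W) ⊆ ⋂ U →
    Disjoint (fromList C ∪ ⋃ W) (fromList D ∪ ⋃ V) →
    let Good : Pred (Subset S) 0ℓ
        Good Z = Σ₂ Z × ((fromList C ∪ ⋃ W) ⊆ Z) × (Z ⊆ ⋂ U)
                 × Disjoint Z (fromList D ∪ ⋃ V)
    in (∃[ Z ] Good Z) × (DisjointFamilies U W → InfiniteFamily Good)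

  AllMoieties : Family S → Set₁
  AllMoieties Σ₀ = ∀ A → Σ₀ A → Moiety A

CountablyInfinite : Set → Set
CountablyInfinite S = S ⤖ ℕ

module Submission where

-- Identify S with the nodes of the infinite binary tree in in-order (left subtree, node, right
-- subtree), a countable dense order. A code is a cut y with a finite table of exceptions; it denotes
-- {x | x ≺ y} modified on the table. Σ₁ consists of the sets of codes whose cut lies strictly between
-- the nodes [false] and [] and ends with an encoding of the table, so that distinct codes denote
-- distinct sets; Σ₂ is its mirror image.
-- Given U, W, V, C, D, let lo be the largest cut of a member of U and hi the smallest cut of a member
-- of W (or [false] and [] if there is none). If lo ≺ hi, a cut in the subtree of a node between them,
-- with a table that fixes Z on C, D and on the tables of the given codes, yields Z; further entries at
-- fresh nodes of that subtree make Z differ from any finitely many given sets. Otherwise the extremal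
-- members of U and W have the same cut, hence coincide: that member is a solution, and U ∩ W ≠ ∅.
-- Membership in the given sets is undecidable, so their codes exist only up to ¬¬. Members of Σ₁
-- therefore also carry explicit almost-inclusions Low ⊆* Z ⊆* ∁ High, which make them moieties, and Z
-- is a predicate defined without the codes that equals the set of its code once the codes are fixed.

open import Defs
open import Level using (0ℓ)
open import Function using (_∘_; id; _⇔_; mk⇔; Equivalence; _↔_; mk↔; mk↔ₛ′; Inverse; case_of_)
open import Function.Properties.Bijection using (⤖⇒↔)
open import Function.Properties.Equivalence using () renaming (trans to ⇔-trans)
open import Function.Properties.Inverse using (↔-trans; ↔-sym)
open import Data.Bool using (Bool; true; false; not; T)
import Data.Bool as Bool
open import Data.Bool.Properties using (T?; not-involutive)
open import Data.Empty using (⊥; ⊥-elim)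
open import Data.Unit using (⊤)
open import Data.Maybe using (Maybe; just; nothing; maybe′; _<∣>_)
open import Data.Nat using (ℕ; suc; _+_; _≤_; _<_; s≤s)
open import Data.Nat.Properties using (≤-trans; m≤m+n; m≤n+m; <-irrefl; ≤-reflexive; +-monoʳ-≤; n≤1+n; +-suc)
open import Data.Nat.ListAction using (sum)
open import Data.Nat.Binary using (ℕᵇ; zero; 2[1+_]; 1+[2_])
import Data.Nat.Binary.Properties as ℕᵇ
open import Data.List using (List; []; _∷_; _++_; [_]; map; replicate; length; reverse; concatMap)
open import Data.List.Properties using (length-++; length-replicate; ≡-dec; ∷-injective; ∷-injectiveʳ; ++-assoc; reverse-++; reverse-involutive)
open import Data.List.Membership.Propositional using (_∈_; _∉_; lose)
open import Data.List.Membership.Propositional.Properties using (∈-++⁺ˡ; ∈-++⁺ʳ; ∈-map⁺; ∈-map⁻; ∈-concatMap⁺)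
open import Data.List.Relation.Unary.Any using (Any; here; there)
open import Data.List.Relation.Unary.All using (All; []; _∷_)
import Data.List.Relation.Unary.All as All
import Data.List.Relation.Unary.All.Properties as All
open import Data.List.Relation.Binary.Pointwise using (Pointwise; []; _∷_)
open import Data.Product using (∃; ∃-syntax; _×_; _,_; proj₁; proj₂; uncurry)
import Data.Product as Product
open import Data.Sum using (_⊎_; inj₁; inj₂)
import Data.Sum as Sum
open import Effect.Monad using (RawMonad)
open import Relation.Binary using (Rel; Transitive; Irreflexive; Trichotomous; tri<; tri≈; tri>; IsStrictTotalOrder; StrictTotalOrder; DecidableEquality)
open import Relation.Binary.Bundles using (DecTotalOrder)
open import Relation.Binary.PropositionalEquality using (_≡_; _≢_; refl; sym; trans; cong; cong₂; subst; resp₂; isEquivalence; module ≡-Reasoning)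
open import Relation.Nullary using (¬_; Dec; yes; no; ¬?; _×-dec_; _⊎-dec_; isYes; toWitness; fromWitness; contradiction)
open import Relation.Nullary.Decidable using (¬¬-excluded-middle)
open import Relation.Nullary.Negation using (¬¬-Monad; ¬¬-map; contra-diagonal)
open import Relation.Unary using (Decidable; _⊆_; _≐_; _∪_; _∩_; ∁)
open import Relation.Unary.Properties using (≐-refl; ≐-sym; ≐-trans)

open RawMonad (¬¬-Monad {0ℓ}) using (_>>=_; pure)

infix 4 _⊆*_

_⊆*_ : {S : Set} → Subset S → Subset S → Set
A ⊆* B = ∃[ E ] (∀ {x} → x ∉ E → A x → B x)

module _ {S : Set} where

  ∉-++⁻ : ∀ {x : S} xs {ys} → x ∉ xs ++ ys → x ∉ xs × x ∉ ys
  ∉-++⁻ xs x∉ = x∉ ∘ ∈-++⁺ˡ , x∉ ∘ ∈-++⁺ʳ xs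

  ⊆⇒⊆* : ∀ {A B : Subset S} → A ⊆ B → A ⊆* B
  ⊆⇒⊆* A⊆B = [] , λ _ → A⊆B

  ⊆*-trans : ∀ {A B C : Subset S} → A ⊆* B → B ⊆* C → A ⊆* C
  ⊆*-trans (E , A⊆B) (E′ , B⊆C) = E ++ E′ , λ x∉ → B⊆C (proj₂ (∉-++⁻ E x∉)) ∘ A⊆B (proj₁ (∉-++⁻ E x∉))

  ⊆*-∩ : ∀ {A B C : Subset S} → A ⊆* B → A ⊆* C → A ⊆* B ∩ C
  ⊆*-∩ (E , A⊆B) (E′ , A⊆C) = E ++ E′ , λ x∉ a → A⊆B (proj₁ (∉-++⁻ E x∉)) a , A⊆C (proj₂ (∉-++⁻ E x∉)) a

  ∪-⊆* : ∀ {A B C : Subset S} → A ⊆* C → B ⊆* C → A ∪ B ⊆* C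
  ∪-⊆* (E , A⊆C) (E′ , B⊆C) = E ++ E′ , λ x∉ → Sum.[ A⊆C (proj₁ (∉-++⁻ E x∉)) , B⊆C (proj₂ (∉-++⁻ E x∉)) ]

  ⊆*-⋂ : ∀ {A : Subset S} {Bs} → All (A ⊆*_) Bs → A ⊆* ⋂ Bs
  ⊆*-⋂ []           = ⊆⇒⊆* _
  ⊆*-⋂ (A⊆B ∷ A⊆Bs) = ⊆*-∩ A⊆B (⊆*-⋂ A⊆Bs)

  ⋃-⊆* : ∀ {As} {B : Subset S} → All (_⊆* B) As → ⋃ As ⊆* B
  ⋃-⊆* []           = ⊆⇒⊆* λ ()
  ⋃-⊆* (A⊆B ∷ As⊆B) = ∪-⊆* A⊆B (⋃-⊆* As⊆B)

  fromList-⊆* : ∀ xs {B : Subset S} → fromList xs ⊆* B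
  fromList-⊆* xs = xs , λ x∉ x∈ → contradiction x∈ x∉

  ⊆*-∁ : ∀ {A B : Subset S} → A ⊆* ∁ B → B ⊆* ∁ A
  ⊆*-∁ (E , A⊆∁B) = E , λ x∉ b a → A⊆∁B x∉ a b

  Infinite-⊆* : ∀ {A B : Subset S} → Infinite A → A ⊆* B → Infinite B
  Infinite-⊆* infinite (E , A⊆B) xs with infinite (E ++ xs)
  ... | x , a , x∉ = x , A⊆B (proj₁ (∉-++⁻ E x∉)) a , proj₂ (∉-++⁻ E x∉)

  ⋃-map⇔Any : ∀ {B : Set} {f : B → Subset S} {ys x} → ⋃ (map f ys) x ⇔ Any (λ y → f y x) ys
  ⋃-map⇔Any = mk⇔ to from
    where
    to : ∀ {B : Set} {f : B → Subset S} {ys x} → ⋃ (map f ys) x → Any (λ y → f y x) ys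
    to {ys = _ ∷ _} (inj₁ fx) = here fx
    to {ys = _ ∷ _} (inj₂ u)  = there (to u)
    from : ∀ {B : Set} {f : B → Subset S} {ys x} → Any (λ y → f y x) ys → ⋃ (map f ys) x
    from (here fx) = inj₁ fx
    from (there u) = inj₂ (from u)

  ⋂-map⇔All : ∀ {B : Set} {f : B → Subset S} {ys x} → ⋂ (map f ys) x ⇔ All (λ y → f y x) ys
  ⋂-map⇔All = mk⇔ to from
    where
    to : ∀ {B : Set} {f : B → Subset S} {ys x} → ⋂ (map f ys) x → All (λ y → f y x) ys
    to {ys = []}    _        = []
    to {ys = _ ∷ _} (fx , i) = fx ∷ to i
    from : ∀ {B : Set} {f : B → Subset S} {ys x} → All (λ y → f y x) ys → ⋂ (map f ys) x
    from []       = _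
    from (fx ∷ i) = fx , from i

  ⋃-∈ : ∀ {A : Subset S} {As} → A ∈ As → A ⊆ ⋃ As
  ⋃-∈ (here refl) a = inj₁ a
  ⋃-∈ (there A∈)  a = inj₂ (⋃-∈ A∈ a)

  ⋂-∈ : ∀ {A : Subset S} {As} → A ∈ As → ⋂ As ⊆ A
  ⋂-∈ (here refl) (a , _) = a
  ⋂-∈ (there A∈)  (_ , i) = ⋂-∈ A∈ i

  ∪-≐ : ∀ {A A′ B B′ : Subset S} → A ≐ A′ → B ≐ B′ → A ∪ B ≐ A′ ∪ B′
  ∪-≐ (A⊆ , ⊆A) (B⊆ , ⊆B) = Sum.map A⊆ B⊆ , Sum.map ⊆A ⊆B

  ∩-≐ : ∀ {A A′ B B′ : Subset S} → A ≐ A′ → B ≐ B′ → A ∩ B ≐ A′ ∩ B′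
  ∩-≐ (A⊆ , ⊆A) (B⊆ , ⊆B) = Product.map A⊆ B⊆ , Product.map ⊆A ⊆B

  ∁-≐ : ∀ {A B : Subset S} → A ≐ B → ∁ A ≐ ∁ B
  ∁-≐ (A⊆B , B⊆A) = (_∘ B⊆A) , (_∘ A⊆B)

  ⋃? : ∀ {As : List (Subset S)} → All Decidable As → Decidable (⋃ As)
  ⋃? []         x = no λ ()
  ⋃? (A? ∷ As?) x = A? x ⊎-dec ⋃? As? x

  ⋂? : ∀ {As : List (Subset S)} → All Decidable As → Decidable (⋂ As)
  ⋂? []         x = yes _
  ⋂? (A? ∷ As?) x = A? x ×-dec ⋂? As? x

  ⋃-cong : ∀ {As Bs : List (Subset S)} → Pointwise _≐_ As Bs → ⋃ As ≐ ⋃ Bs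
  ⋃-cong []         = ≐-refl
  ⋃-cong (eq ∷ eqs) = ∪-≐ eq (⋃-cong eqs)

  ⋂-cong : ∀ {As Bs : List (Subset S)} → Pointwise _≐_ As Bs → ⋂ As ≐ ⋂ Bs
  ⋂-cong []         = ≐-refl
  ⋂-cong (eq ∷ eqs) = ∩-≐ eq (⋂-cong eqs)

-- Pointwise R, but in Set although the first list holds subsets, as Admissible below requires.
Zip : {A : Set₁} {B : Set} → (A → B → Set) → List A → List B → Set
Zip R []       []       = ⊤
Zip R (x ∷ xs) (y ∷ ys) = R x y × Zip R xs ys
Zip R _        _        = ⊥

module _ {A : Set₁} {B : Set} {R : A → B → Set} where

  Zip-∈ʳ : ∀ {xs ys y} → Zip R xs ys → y ∈ ys → ∃[ x ] x ∈ xs × R x y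
  Zip-∈ʳ {_ ∷ _} (r , _)  (here refl) = _ , here refl , r
  Zip-∈ʳ {_ ∷ _} (_ , rs) (there y∈)  = Product.map id (Product.map there id) (Zip-∈ʳ rs y∈)

  Zip-All : ∀ {P : B → Set} → (∀ {x y} → R x y → P y) → ∀ {xs ys} → Zip R xs ys → All P ys
  Zip-All R⇒P {[]}    {[]}    _        = []
  Zip-All R⇒P {_ ∷ _} {_ ∷ _} (r , rs) = R⇒P r ∷ Zip-All R⇒P rs

  Zip-unique : (∀ {x y y′} → R x y → R x y′ → y ≡ y′) →
               ∀ {xs ys ys′} → Zip R xs ys → Zip R xs ys′ → ys ≡ ys′
  Zip-unique R-unique {[]}    {[]}    {[]}    _        _          = refl
  Zip-unique R-unique {_ ∷ _} {_ ∷ _} {_ ∷ _} (r , rs) (r′ , rs′) =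
    cong₂ _∷_ (R-unique r r′) (Zip-unique R-unique rs rs′)

  ¬¬-Zip : ∀ {xs} → All (λ x → ¬ ¬ ∃ (R x)) xs → ¬ ¬ ∃ (Zip R xs)
  ¬¬-Zip []         = pure ([] , _)
  ¬¬-Zip (r? ∷ rs?) = do
    y , r   ← r?
    ys , rs ← ¬¬-Zip rs?
    pure (y ∷ ys , r , rs)

Zip-≐-map : ∀ {A B : Set} {R : Subset A → B → Set} {f : B → Subset A} → (∀ {X y} → R X y → X ≐ f y) →
            ∀ {Xs ys} → Zip R Xs ys → Pointwise _≐_ Xs (map f ys)
Zip-≐-map R⇒≐ {[]}    {[]}    _        = []
Zip-≐-map R⇒≐ {_ ∷ _} {_ ∷ _} (r , rs) = R⇒≐ r ∷ Zip-≐-map R⇒≐ rs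

module _ {D X : Set} (P : D → Set) (f : D → Subset X) where

  Chosen : Subset X
  Chosen x = ∃[ d ] P d × f d x

  Chosen-≐ : (∀ {d d′} → P d → P d′ → d ≡ d′) → ∀ {d} → P d → Chosen ≐ f d
  Chosen-≐ P-unique p = (λ { (_ , p′ , x∈) → subst (λ d → f d _) (P-unique p′ p) x∈ }) , (λ x∈ → _ , p , x∈)

Opposes : Bool → Set → Set
Opposes b P = T b ⇔ (¬ P)

¬¬-Opposes : ∀ P → ¬ ¬ ∃ λ b → Opposes b P
¬¬-Opposes P = do
  P? ← ¬¬-excluded-middle
  pure (decide P?)
  where
  decide : Dec P → ∃ λ b → Opposes b P
  decide (yes p) = false , mk⇔ (λ ()) (λ ¬p → ¬p p)
  decide (no ¬p) = true , mk⇔ (λ _ → ¬p) _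

Opposes-unique : ∀ {b b′ P} → Opposes b P → Opposes b′ P → b ≡ b′
Opposes-unique {false} {false} _ _ = refl
Opposes-unique {true}  {true}  _ _ = refl
Opposes-unique {false} {true}  o o′ = ⊥-elim (Equivalence.from o (Equivalence.to o′ _))
Opposes-unique {true}  {false} o o′ = ⊥-elim (Equivalence.from o′ (Equivalence.to o _))

Opposes-⇎ : ∀ {b} {P Q : Set} → Opposes b Q → P ⇔ T b → ¬ (P ⇔ Q)
Opposes-⇎ {Q = Q} o P⇔b P⇔Q = ¬q (Equivalence.to P⇔Q (Equivalence.from P⇔b (Equivalence.from o ¬q)))
  where
  ¬q : ¬ Q
  ¬q = contra-diagonal (Equivalence.to o ∘ Equivalence.to P⇔b ∘ Equivalence.from P⇔Q)

Interpolant : {S : Set} → Family S → List S → List (Subset S) → List (Subset S) →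
              List S → List (Subset S) → Subset S → Set
Interpolant 𝒜 C U W D V Z = 𝒜 Z × (fromList C ∪ ⋃ U) ⊆ Z × Z ⊆ ⋂ W × Disjoint Z (fromList D ∪ ⋃ V)

module _ {S : Set} where

  DisjointFamilies-sym : ∀ {U W : List (Subset S)} → DisjointFamilies U W → DisjointFamilies W U
  DisjointFamilies-sym U#W = All.tabulate λ B∈W → All.tabulate λ A∈U B≐A →
    All.lookup (All.lookup U#W A∈U) B∈W (≐-sym B≐A)

  Cond-i⇒Cond-ii : ∀ {𝒜 ℬ : Family S} → Cond-i ℬ 𝒜 → Cond-ii 𝒜 ℬ
  Cond-i⇒Cond-ii cond U W V C D AU AW AV sub dis =
    Product.map id (λ infinite → infinite ∘ DisjointFamilies-sym) (cond W U V C D AW AU AV sub dis)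

  Cond-i⇒InfiniteFamily : ∀ {𝒜 ℬ : Family S} → Cond-i 𝒜 ℬ → InfiniteFamily 𝒜
  Cond-i⇒InfiniteFamily cond Zs =
    Product.map₂ (Product.map₁ proj₁) (proj₂ (cond [] [] [] [] [] [] [] [] _ nothing-to-avoid) [] Zs)
    where
    nothing-to-avoid : Disjoint (fromList [] ∪ ⋃ []) (fromList [] ∪ ⋃ [])
    nothing-to-avoid _ (inj₁ ()) _
    nothing-to-avoid _ (inj₂ ()) _

  Cond-i-monoʳ : ∀ {𝒜 ℬ ℬ′ : Family S} → ℬ′ ⊆ ℬ → Cond-i 𝒜 ℬ → Cond-i 𝒜 ℬ′
  Cond-i-monoʳ ℬ′⊆ℬ cond U W V C D AU AW AV = cond U W V C D AU AW (All.map ℬ′⊆ℬ AV)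

module Transport {S T : Set} (ι : S ↔ T) where

  open Inverse ι using (to; from; strictlyInverseˡ; strictlyInverseʳ)

  image : Subset S → Subset T
  image A = A ∘ from

  preimage : Subset T → Subset S
  preimage Z = Z ∘ to

  _⁺ : Family T → Family S
  (𝒜 ⁺) A = 𝒜 (image A)

  image-preimage : ∀ Z → image (preimage Z) ≐ Z
  image-preimage Z = (λ {y} → subst Z (strictlyInverseˡ y)) , (λ {y} → subst Z (sym (strictlyInverseˡ y)))

  preimage-image : ∀ A → preimage (image A) ≐ A
  preimage-image A = (λ {x} → subst A (strictlyInverseʳ x)) , (λ {x} → subst A (sym (strictlyInverseʳ x)))

  image-cong : ∀ {A B} → A ≐ B → image A ≐ image B
  image-cong (A⊆B , B⊆A) = (λ {y} → A⊆B {from y}) , (λ {y} → B⊆A {from y})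

  preimage-cong : ∀ {Z Z′} → Z ≐ Z′ → preimage Z ≐ preimage Z′
  preimage-cong (Z⊆Z′ , Z′⊆Z) = (λ {x} → Z⊆Z′ {to x}) , (λ {x} → Z′⊆Z {to x})

  image-fromList : ∀ C → image (fromList C) ≐ fromList (map to C)
  image-fromList C =
    (λ {y} x∈ → subst (_∈ map to C) (strictlyInverseˡ y) (∈-map⁺ to x∈)) ,
    (λ y∈ → case ∈-map⁻ to y∈ of λ { (x , x∈ , refl) → subst (_∈ C) (sym (strictlyInverseʳ x)) x∈ })

  image-⋃ : ∀ As → image (⋃ As) ≐ ⋃ (map image As)
  image-⋃ []       = ≐-refl
  image-⋃ (A ∷ As) = ∪-≐ ≐-refl (image-⋃ As)

  image-⋂ : ∀ As → image (⋂ As) ≐ ⋂ (map image As)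
  image-⋂ []       = ≐-refl
  image-⋂ (A ∷ As) = ∩-≐ ≐-refl (image-⋂ As)

  ⊆*-image⁻ : ∀ {A Z} → image A ⊆* Z → A ⊆* preimage Z
  ⊆*-image⁻ {A} (E , A⊆Z) = map from E , λ {x} x∉ a →
    A⊆Z (λ tx∈ → x∉ (subst (_∈ map from E) (strictlyInverseʳ x) (∈-map⁺ from tx∈)))
        (proj₂ (preimage-image A) a)

  image-≐⇒ : ∀ {A Z} → image A ≐ Z → A ≐ preimage Z
  image-≐⇒ {A} eq = ≐-trans (≐-sym (preimage-image A)) (preimage-cong eq)

  image-injective : ∀ {A B} → image A ≐ image B → A ≐ B
  image-injective {B = B} eq = ≐-trans (image-≐⇒ eq) (preimage-image B)

  Extensional⁺ : ∀ {𝒜} → Extensional 𝒜 → Extensional (𝒜 ⁺)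
  Extensional⁺ ext = ext ∘ image-cong

  Infinite-image⁻ : ∀ {A} → Infinite (image A) → Infinite A
  Infinite-image⁻ infinite xs with infinite (map to xs)
  ... | y , a , y∉ = from y , a , λ x∈ → y∉ (subst (_∈ map to xs) (strictlyInverseˡ y) (∈-map⁺ to x∈))

  AllMoieties⁺ : ∀ {𝒜} → AllMoieties 𝒜 → AllMoieties (𝒜 ⁺)
  AllMoieties⁺ moieties A A∈ = Product.map Infinite-image⁻ Infinite-image⁻ (moieties (image A) A∈)

  Cond-i⁺ : ∀ {𝒜 ℬ} → Extensional 𝒜 → Cond-i 𝒜 ℬ → Cond-i (𝒜 ⁺) (ℬ ⁺)
  Cond-i⁺ {𝒜} ext cond U W V C D AU AW AV sub dis =
    Product.map (Product.map preimage pull)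
                (λ infinite U#W Zs → pull-new Zs (infinite (push-disjoint U#W) (map image Zs)))
                (cond (map image U) (map image W) (map image V) (map to C) (map to D)
                      (All.map⁺ AU) (All.map⁺ AW) (All.map⁺ AV)
                      (proj₁ (image-⋂ W) ∘ sub ∘ proj₂ (push C U))
                      (λ y l u → dis (from y) (proj₂ (push C U) l) (proj₂ (push D V) u)))
    where
    push : ∀ C U → image (fromList C ∪ ⋃ U) ≐ fromList (map to C) ∪ ⋃ (map image U)
    push C U = ∪-≐ (image-fromList C) (image-⋃ U)
    pull : ∀ {Z} → Interpolant 𝒜 (map to C) (map image U) (map image W) (map to D) (map image V) Z →
           Interpolant (𝒜 ⁺) C U W D V (preimage Z)
    pull {Z} (Z∈ , lower , upper , avoid) =
      ext (≐-sym (image-preimage Z)) Z∈ ,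
      lower ∘ proj₁ (push C U) ∘ proj₂ (preimage-image (fromList C ∪ ⋃ U)) ,
      proj₁ (preimage-image (⋂ W)) ∘ proj₂ (image-⋂ W) ∘ upper ,
      λ x z u → avoid (to x) z (proj₁ (push D V) (proj₂ (preimage-image (fromList D ∪ ⋃ V)) u))
    push-disjoint : DisjointFamilies U W → DisjointFamilies (map image U) (map image W)
    push-disjoint = All.map⁺ ∘ All.map (λ A#W → All.map⁺ (All.map (_∘ image-injective) A#W))
    pull-new : ∀ Zs → ∃ (λ Z → Interpolant 𝒜 (map to C) (map image U) (map image W) (map to D) (map image V) Z
                               × All (λ Y → ¬ Z ≐ Y) (map image Zs)) →
               ∃ (λ Z → Interpolant (𝒜 ⁺) C U W D V Z × All (λ Y → ¬ Z ≐ Y) Zs)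
    pull-new Zs (Z , Z-interpolant , Z-new) =
      preimage Z , pull Z-interpolant ,
      All.map (λ Z≠Y eq → Z≠Y (≐-trans (≐-sym (image-preimage Z)) (image-cong eq))) (All.map⁻ Z-new)

Node : Set
Node = List Bool

infix 4 _≺_

data _≺_ : Rel Node 0ℓ where
  root≺right  : ∀ {b}   → [] ≺ true ∷ b
  left≺root   : ∀ {a}   → false ∷ a ≺ []
  left≺right  : ∀ {a b} → false ∷ a ≺ true ∷ b
  left≺left   : ∀ {a b} → a ≺ b → false ∷ a ≺ false ∷ b
  right≺right : ∀ {a b} → a ≺ b → true ∷ a ≺ true ∷ b

≺-trans : Transitive _≺_
≺-trans root≺right      (right≺right _) = root≺right
≺-trans left≺root       root≺right      = left≺right
≺-trans left≺right      (right≺right _) = left≺right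
≺-trans (left≺left _)   left≺root       = left≺root
≺-trans (left≺left _)   left≺right      = left≺right
≺-trans (left≺left p)   (left≺left q)   = left≺left (≺-trans p q)
≺-trans (right≺right p) (right≺right q) = right≺right (≺-trans p q)

≺-irrefl : Irreflexive _≡_ _≺_
≺-irrefl refl (left≺left p)   = ≺-irrefl refl p
≺-irrefl refl (right≺right p) = ≺-irrefl refl p

≺-asym : ∀ {a b} → a ≺ b → ¬ b ≺ a
≺-asym p q = ≺-irrefl refl (≺-trans p q)

≺-connected : ∀ a b → a ≺ b ⊎ a ≡ b ⊎ b ≺ a
≺-connected []          []          = inj₂ (inj₁ refl)
≺-connected []          (false ∷ b) = inj₂ (inj₂ left≺root)
≺-connected []          (true ∷ b)  = inj₁ root≺right
≺-connected (false ∷ a) []          = inj₁ left≺root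
≺-connected (true ∷ a)  []          = inj₂ (inj₂ root≺right)
≺-connected (false ∷ a) (true ∷ b)  = inj₁ left≺right
≺-connected (true ∷ a)  (false ∷ b) = inj₂ (inj₂ left≺right)
≺-connected (false ∷ a) (false ∷ b) with ≺-connected a b
... | inj₁ p          = inj₁ (left≺left p)
... | inj₂ (inj₁ p)   = inj₂ (inj₁ (cong (false ∷_) p))
... | inj₂ (inj₂ p)   = inj₂ (inj₂ (left≺left p))
≺-connected (true ∷ a)  (true ∷ b)  with ≺-connected a b
... | inj₁ p          = inj₁ (right≺right p)
... | inj₂ (inj₁ p)   = inj₂ (inj₁ (cong (true ∷_) p))
... | inj₂ (inj₂ p)   = inj₂ (inj₂ (right≺right p))

≺-compare : Trichotomous _≡_ _≺_
≺-compare a b with ≺-connected a b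
... | inj₁ p        = tri< p (λ { refl → ≺-irrefl refl p }) (≺-asym p)
... | inj₂ (inj₁ p) = tri≈ (≺-irrefl p) p (≺-irrefl (sym p))
... | inj₂ (inj₂ p) = tri> (≺-asym p) (λ { refl → ≺-irrefl refl p }) p

≺-isStrictTotalOrder : IsStrictTotalOrder _≡_ _≺_
≺-isStrictTotalOrder = record
  { isStrictPartialOrder = record
    { isEquivalence = isEquivalence
    ; irrefl        = ≺-irrefl
    ; trans         = ≺-trans
    ; <-resp-≈      = resp₂ _≺_
    }
  ; compare = ≺-compare
  }

_≺?_ : ∀ a b → Dec (a ≺ b)
_≺?_ = IsStrictTotalOrder._<?_ ≺-isStrictTotalOrder

≺-strictTotalOrder : StrictTotalOrder 0ℓ 0ℓ 0ℓ
≺-strictTotalOrder = record { isStrictTotalOrder = ≺-isStrictTotalOrder }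

left-subtree-≺ : ∀ m w → (m ++ [ false ]) ++ w ≺ m
left-subtree-≺ []          w = left≺root
left-subtree-≺ (false ∷ m) w = left≺left (left-subtree-≺ m w)
left-subtree-≺ (true ∷ m)  w = right≺right (left-subtree-≺ m w)

≺-right-subtree : ∀ a w → a ≺ (a ++ [ true ]) ++ w
≺-right-subtree []          w = root≺right
≺-right-subtree (false ∷ a) w = left≺left (≺-right-subtree a w)
≺-right-subtree (true ∷ a)  w = right≺right (≺-right-subtree a w)

between : Node → Node → Node
between (false ∷ a) (false ∷ m) = false ∷ between a m
between (true ∷ a)  (true ∷ m)  = true ∷ between a m
between []          m           = m ++ [ false ]
between a           _           = a ++ [ true ]

between-≺ : ∀ {a m} → a ≺ m → ∀ w → a ≺ between a m ++ w × between a m ++ w ≺ m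
between-≺ {m = m} root≺right w = root≺right , left-subtree-≺ m w
between-≺ {a = a} left≺root  w = ≺-right-subtree a w , left≺root
between-≺ {a = a} left≺right w = ≺-right-subtree a w , left≺right
between-≺ (left≺left p)   w with between-≺ p w
... | a≺ , ≺m = left≺left a≺ , left≺left ≺m
between-≺ (right≺right p) w with between-≺ p w
... | a≺ , ≺m = right≺right a≺ , right≺right ≺m

mirror : Node → Node
mirror = map not

mirror-involutive : ∀ a → mirror (mirror a) ≡ a
mirror-involutive []      = refl
mirror-involutive (b ∷ a) = cong₂ _∷_ (not-involutive b) (mirror-involutive a)

mirror-≺ : ∀ {a b} → a ≺ b → mirror b ≺ mirror a
mirror-≺ root≺right      = left≺root
mirror-≺ left≺root       = root≺right
mirror-≺ left≺right      = left≺right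
mirror-≺ (left≺left p)   = right≺right (mirror-≺ p)
mirror-≺ (right≺right p) = left≺left (mirror-≺ p)

extend : Node → ℕ → Node
extend ν k = ν ++ replicate k true

length-extend : ∀ ν k → length (extend ν k) ≡ length ν + k
length-extend ν k = trans (length-++ ν {replicate k true}) (cong (length ν +_) (length-replicate k {true}))

long-∉ : ∀ {x : Node} xs → sum (map length xs) < length x → x ∉ xs
long-∉ (y ∷ ys) long (here refl) = <-irrefl refl (≤-trans long (m≤m+n (length y) _))
long-∉ (y ∷ ys) long (there x∈) = long-∉ ys (≤-trans long′ long) x∈
  where
  long′ : sum (map length ys) < suc (length y + sum (map length ys))
  long′ = s≤s (m≤n+m _ (length y))

fresh : Node → List Node → Node
fresh ν xs = extend ν (suc (sum (map length xs)))

fresh-∉ : ∀ ν xs → fresh ν xs ∉ xs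
fresh-∉ ν xs = long-∉ {fresh ν xs} xs (≤-trans (m≤n+m _ (length ν)) (≤-reflexive (sym (length-extend ν _))))

infix 4 _≟_

_≟_ : DecidableEquality Node
_≟_ = ≡-dec Bool._≟_

open import Data.List.Membership.DecPropositional _≟_ using (_∈?_)

Table : Set
Table = List (Node × Bool)

keys : Table → List Node
keys = map proj₁

lookup : Table → Node → Maybe Bool
lookup []            x = nothing
lookup ((k , b) ∷ F) x with k ≟ x
... | yes _ = just b
... | no  _ = lookup F x

lookup-here : ∀ {k b F} → lookup ((k , b) ∷ F) k ≡ just b
lookup-here {k} with k ≟ k
... | yes _   = refl
... | no k≢k = ⊥-elim (k≢k refl)

lookup-there : ∀ {k b F x} → k ≢ x → lookup ((k , b) ∷ F) x ≡ lookup F x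
lookup-there {k} {x = x} k≢x with k ≟ x
... | yes k≡x = ⊥-elim (k≢x k≡x)
... | no  _   = refl

lookup-++ : ∀ F G x → lookup (F ++ G) x ≡ (lookup F x <∣> lookup G x)
lookup-++ []            G x = refl
lookup-++ ((k , b) ∷ F) G x with k ≟ x
... | yes _ = refl
... | no  _ = lookup-++ F G x

lookup-∉ : ∀ {F x} → x ∉ keys F → lookup F x ≡ nothing
lookup-∉ {[]}          x∉ = refl
lookup-∉ {(k , b) ∷ F} {x} x∉ with k ≟ x
... | yes refl = ⊥-elim (x∉ (here refl))
... | no  _    = lookup-∉ (x∉ ∘ there)

lookup-just⇒∈ : ∀ {F x b} → lookup F x ≡ just b → x ∈ keys F
lookup-just⇒∈ {F} {x} found with x ∈? keys F
... | yes x∈ = x∈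
... | no  x∉ with () ← trans (sym found) (lookup-∉ x∉)

graph : (Node → Bool) → List Node → Table
graph t = map (λ e → e , t e)

lookup-graph-∈ : ∀ {t E x} → x ∈ E → lookup (graph t E) x ≡ just (t x)
lookup-graph-∈ {E = e ∷ E} {x} x∈ with e ≟ x | x∈
... | yes refl | _         = refl
... | no  e≢x  | here refl = ⊥-elim (e≢x refl)
... | no  _    | there x∈′ = lookup-graph-∈ x∈′

lookup-graph-∉ : ∀ {t E x} → x ∉ E → lookup (graph t E) x ≡ nothing
lookup-graph-∉ {E = []}    x∉ = refl
lookup-graph-∉ {E = e ∷ E} {x} x∉ with e ≟ x
... | yes refl = ⊥-elim (x∉ (here refl))
... | no  _    = lookup-graph-∉ (x∉ ∘ there)

record Code : Set where
  constructor code
  field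
    cut   : Node
    table : Table

open Code

⟦_⟧ : Code → Subset Node
⟦ c ⟧ x = maybe′ T (x ≺ cut c) (lookup (table c) x)

⟦⟧-lookup : ∀ {c x r} → lookup (table c) x ≡ r → ⟦ c ⟧ x ⇔ maybe′ T (x ≺ cut c) r
⟦⟧-lookup refl = mk⇔ id id

⟦⟧-off-table : ∀ {c x} → x ∉ keys (table c) → ⟦ c ⟧ x ⇔ x ≺ cut c
⟦⟧-off-table {c} x∉ = ⟦⟧-lookup {c} (lookup-∉ x∉)

⟦_⟧? : ∀ c → Decidable ⟦ c ⟧
⟦ c ⟧? x with lookup (table c) x
... | just b  = T? b
... | nothing = x ≺? cut c

⟦⟧-sandwich : ∀ {a m} c → a ≺ cut c → cut c ≺ m → All (λ k → a ≺ k × k ≺ m) (keys (table c)) →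
              ∀ x → (x ≺ a → ⟦ c ⟧ x) × (⟦ c ⟧ x → x ≺ m)
⟦⟧-sandwich c a≺cut cut≺m keys-between x with lookup (table c) x in found
... | nothing = (λ x≺a → ≺-trans x≺a a≺cut) , (λ x≺cut → ≺-trans x≺cut cut≺m)
... | just b  with All.lookup keys-between (lookup-just⇒∈ found)
...   | a≺x , x≺m = (λ x≺a → ⊥-elim (≺-asym a≺x x≺a)) , (λ _ → x≺m)

encodeNode : Node → List Bool
encodeNode []      = [ false ]
encodeNode (b ∷ a) = true ∷ b ∷ encodeNode a

encode : Table → List Bool
encode []            = [ false ]
encode ((k , b) ∷ F) = true ∷ b ∷ encodeNode k ++ encode F

encodeNode-prefix : ∀ a a′ {r r′} → encodeNode a ++ r ≡ encodeNode a′ ++ r′ → a ≡ a′ × r ≡ r′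
encodeNode-prefix []      []        eq = refl , ∷-injectiveʳ eq
encodeNode-prefix (b ∷ a) (b′ ∷ a′) eq with ∷-injective (∷-injectiveʳ eq)
... | refl , eq′ with encodeNode-prefix a a′ eq′
...   | refl , refl = refl , refl

encode-prefix : ∀ F F′ {r r′} → encode F ++ r ≡ encode F′ ++ r′ → F ≡ F′
encode-prefix []            []              eq = refl
encode-prefix ((k , b) ∷ F) ((k′ , b′) ∷ F′) {r} {r′} eq with ∷-injective (∷-injectiveʳ eq)
... | refl , eq′ with encodeNode-prefix k k′ (trans (sym (++-assoc (encodeNode k) (encode F) r))
                                             (trans eq′ (++-assoc (encodeNode k′) (encode F′) r′)))
...   | refl , eq″ = cong (_ ∷_) (encode-prefix F F′ eq″)

-- The cut ends with the reversed prefix code of the table, so the cut determines the table.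
Valid : Code → Set
Valid c = ∃[ ν ] cut c ≡ ν ++ reverse (encode (table c))

valid-cut⇒table : ∀ {c c′} → Valid c → Valid c′ → cut c ≡ cut c′ → table c ≡ table c′
valid-cut⇒table {c} {c′} (ν , refl) (ν′ , refl) same =
  encode-prefix (table c) (table c′) (begin
    encode (table c) ++ reverse ν                   ≡⟨ unreverse ν (encode (table c)) ⟨
    reverse (ν ++ reverse (encode (table c)))     ≡⟨ cong reverse same ⟩
    reverse (ν′ ++ reverse (encode (table c′)))   ≡⟨ unreverse ν′ (encode (table c′)) ⟩
    encode (table c′) ++ reverse ν′                 ∎)
  where
  open ≡-Reasoning
  unreverse : ∀ ν e → reverse (ν ++ reverse e) ≡ e ++ reverse ν
  unreverse ν e = trans (reverse-++ ν (reverse e)) (cong (_++ reverse ν) (reverse-involutive e))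

open import Relation.Binary.Properties.StrictTotalOrder ≺-strictTotalOrder
  using () renaming (_≤_ to _≼_; decTotalOrder to ≼-decTotalOrder; antisym to ≼-antisym)

open import Data.List.Extrema (DecTotalOrder.totalOrder ≼-decTotalOrder)
  using (argmax; argmin; argmax-sel; argmin-sel; argmax-all; argmin-all; f[⊥]≤f[argmax]; f[argmin]≤f[⊤]; f[xs]≤f[argmax]; f[argmin]≤f[xs])

≺-≼-trans : ∀ {a b c} → a ≺ b → b ≼ c → a ≺ c
≺-≼-trans a≺b (inj₁ b≺c)  = ≺-trans a≺b b≺c
≺-≼-trans a≺b (inj₂ refl) = a≺b

≼-≺-trans : ∀ {a b c} → a ≼ b → b ≺ c → a ≺ c
≼-≺-trans (inj₁ a≺b)  b≺c = ≺-trans a≺b b≺c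
≼-≺-trans (inj₂ refl) b≺c = b≺c

-- Otherwise a fresh node strictly between the cuts would lie in ⟦ c ⟧ but not in ⟦ c′ ⟧.
cut-mono : ∀ {c c′} → ⟦ c ⟧ ⊆ ⟦ c′ ⟧ → cut c ≼ cut c′
cut-mono {c} {c′} c⊆c′ with ≺-compare (cut c) (cut c′)
... | tri< c≺c′ _ _ = inj₁ c≺c′
... | tri≈ _ c≡c′ _ = inj₂ c≡c′
... | tri> _ _ c′≺c = ⊥-elim (≺-asym (proj₁ p-between) (Equivalence.to (⟦⟧-off-table {c′} p∉c′) p∈c′))
  where
  exceptions : List Node
  exceptions = keys (table c) ++ keys (table c′)
  p : Node
  p = fresh (between (cut c′) (cut c)) exceptions
  p-between : cut c′ ≺ p × p ≺ cut c
  p-between = between-≺ c′≺c _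
  p∉c : p ∉ keys (table c)
  p∉c = fresh-∉ _ exceptions ∘ ∈-++⁺ˡ
  p∉c′ : p ∉ keys (table c′)
  p∉c′ = fresh-∉ _ exceptions ∘ ∈-++⁺ʳ (keys (table c))
  p∈c′ : ⟦ c′ ⟧ p
  p∈c′ = c⊆c′ (Equivalence.from (⟦⟧-off-table {c} p∉c) (proj₂ p-between))

valid-cut-injective : ∀ {c c′} → Valid c → Valid c′ → cut c ≡ cut c′ → c ≡ c′
valid-cut-injective valid valid′ same-cut = cong₂ code same-cut (valid-cut⇒table valid valid′ same-cut)

⟦⟧-injective : ∀ {c c′} → Valid c → Valid c′ → ⟦ c ⟧ ≐ ⟦ c′ ⟧ → c ≡ c′
⟦⟧-injective {c} {c′} valid valid′ (c⊆c′ , c′⊆c) =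
  valid-cut-injective valid valid′ (≼-antisym (cut-mono {c} {c′} c⊆c′) (cut-mono {c′} {c} c′⊆c))

Any⟦⟧⇒Any≺cut : ∀ {x cs} → All (λ c → x ∉ keys (table c)) cs →
                Any (λ c → ⟦ c ⟧ x) cs → Any (λ c → x ≺ cut c) cs
Any⟦⟧⇒Any≺cut {cs = c ∷ _} (x∉ ∷ _)  (here x∈) = here (Equivalence.to (⟦⟧-off-table {c} x∉) x∈)
Any⟦⟧⇒Any≺cut             (_ ∷ x∉s) (there i) = there (Any⟦⟧⇒Any≺cut x∉s i)

All≺cut⇒All⟦⟧ : ∀ {x cs} → All (λ c → x ∉ keys (table c)) cs →
                All (λ c → x ≺ cut c) cs → All (λ c → ⟦ c ⟧ x) cs
All≺cut⇒All⟦⟧ {cs = []}    []         []           = []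
All≺cut⇒All⟦⟧ {cs = c ∷ _} (x∉ ∷ x∉s) (x≺ ∷ x≺s) =
  Equivalence.from (⟦⟧-off-table {c} x∉) x≺ ∷ All≺cut⇒All⟦⟧ x∉s x≺s

keysOf : List Code → List Node
keysOf = concatMap (keys ∘ table)

∉-keysOf : ∀ {x cs} → x ∉ keysOf cs → All (λ c → x ∉ keys (table c)) cs
∉-keysOf x∉ = All.tabulate λ c∈ x∈ → x∉ (∈-concatMap⁺ (keys ∘ table) (lose c∈ x∈))

diagonal : Node → ℕ → List Bool → Table
diagonal ν k []       = []
diagonal ν k (b ∷ bs) = (extend ν k , b) ∷ diagonal ν (suc k) bs

Diagonalises : Node → ℕ → List (Subset Node) → List Bool → Set
Diagonalises ν k []       []       = ⊤
Diagonalises ν k (Y ∷ Ys) (b ∷ bs) = Opposes b (Y (extend ν k)) × Diagonalises ν (suc k) Ys bs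
Diagonalises ν k _        _        = ⊥

¬¬-Diagonalises : ∀ ν k Ys → ¬ ¬ ∃ (Diagonalises ν k Ys)
¬¬-Diagonalises ν k []       = pure ([] , _)
¬¬-Diagonalises ν k (Y ∷ Ys) = do
  b , opposes     ← ¬¬-Opposes (Y (extend ν k))
  bs , diagonalises ← ¬¬-Diagonalises ν (suc k) Ys
  pure (b ∷ bs , opposes , diagonalises)

Diagonalises-unique : ∀ {ν k Ys bs bs′} → Diagonalises ν k Ys bs → Diagonalises ν k Ys bs′ → bs ≡ bs′
Diagonalises-unique {Ys = []}    {[]}    {[]}    _        _          = refl
Diagonalises-unique {Ys = _ ∷ _} {_ ∷ _} {_ ∷ _} (o , os) (o′ , os′) =
  cong₂ _∷_ (Opposes-unique o o′) (Diagonalises-unique os os′)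

diagonal-keys : ∀ {P : Node → Set} {ν} → (∀ w → P (ν ++ w)) → ∀ k bs → All P (keys (diagonal ν k bs))
diagonal-keys in-subtree k []       = []
diagonal-keys in-subtree k (b ∷ bs) = in-subtree _ ∷ diagonal-keys in-subtree (suc k) bs

diagonal-witness : ∀ {ν k Ys bs Y} → Diagonalises ν k Ys bs → Y ∈ Ys →
                   ∃[ p ] ∃[ b ] length ν + k ≤ length p × lookup (diagonal ν k bs) p ≡ just b
                                 × Opposes b (Y p)
diagonal-witness {ν} {k} {_ ∷ _} {b ∷ bs} (o , _) (here refl) =
  extend ν k , b , ≤-reflexive (sym (length-extend ν k)) ,
  lookup-here {extend ν k} {F = diagonal ν (suc k) bs} , o
diagonal-witness {ν} {k} {_ ∷ _} {_ ∷ _} (_ , os) (there Y∈) with diagonal-witness os Y∈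
... | p , b , deep , found , o with extend ν k ≟ p
...   | no k≢p   = p , b , ≤-trans (+-monoʳ-≤ (length ν) (n≤1+n k)) deep , trans (lookup-there k≢p) found , o
...   | yes refl = ⊥-elim (<-irrefl (sym (length-extend ν k)) (subst (_≤ length p) (+-suc (length ν) k) deep))

mirror↔ : Node ↔ Node
mirror↔ = mk↔ₛ′ mirror mirror mirror-involutive mirror-involutive

module Mirror = Transport mirror↔

Low High : Subset Node
Low x  = x ≺ [ false ]
High x = [] ≺ x

Low∩High-empty : ∀ {x} → Low x → ¬ High x
Low∩High-empty low high = ≺-irrefl refl (≺-trans (≺-trans low left≺root) high)

Low-infinite : Infinite Low
Low-infinite xs = fresh (false ∷ false ∷ []) xs , left≺left left≺root , fresh-∉ (false ∷ false ∷ []) xs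

High-infinite : Infinite High
High-infinite xs = fresh [ true ] xs , root≺right , fresh-∉ [ true ] xs

Middle : Node → Set
Middle y = [ false ] ≺ y × y ≺ []

Good : Code → Set
Good c = Valid c × Middle (cut c)

Coded : Subset Node → Code → Set
Coded A c = Good c × A ≐ ⟦ c ⟧

Coded-unique : ∀ {A c c′} → Coded A c → Coded A c′ → c ≡ c′
Coded-unique (good , A≐c) (good′ , A≐c′) =
  ⟦⟧-injective (proj₁ good) (proj₁ good′) (≐-trans (≐-sym A≐c) A≐c′)

Initials : Family Node
Initials Z = Low ⊆* Z × Z ⊆* ∁ High × ¬ ¬ ∃ (Coded Z)

Finals : Family Node
Finals = Mirror._⁺ Initials

Initials-extensional : Extensional Initials
Initials-extensional {A} {B} A≐B (low , high , coded) =
  ⊆*-trans low (⊆⇒⊆* (proj₁ A≐B)) , ⊆*-trans (⊆⇒⊆* (proj₂ A≐B)) high ,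
  ¬¬-map (Product.map id (Product.map id (≐-trans (≐-sym A≐B)))) coded

Finals-extensional : Extensional Finals
Finals-extensional = Mirror.Extensional⁺ Initials-extensional

Initials-moieties : AllMoieties Initials
Initials-moieties Z (low , high , _) = Infinite-⊆* Low-infinite low , Infinite-⊆* High-infinite (⊆*-∁ high)

Finals-moieties : AllMoieties Finals
Finals-moieties = Mirror.AllMoieties⁺ Initials-moieties

Finals⇒⊆*∁Low : ∀ {B} → Finals B → B ⊆* ∁ Low
Finals⇒⊆*∁Low (_ , high , _) =
  ⊆*-trans (Mirror.⊆*-image⁻ high) (⊆⇒⊆* λ not-high low → not-high (low⇒mirror-high low))
  where
  low⇒mirror-high : ∀ {x} → Low x → High (mirror x)
  low⇒mirror-high low = ≺-trans root≺right (mirror-≺ low)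

floor-code ceiling-code : Code
floor-code   = code [ false ] []
ceiling-code = code [] []

record Codes : Set where
  constructor codes
  field
    codesU codesW codesV : List Code

open Codes

module Construction
  (U W V : List (Subset Node)) (C D : List Node)
  (AU : All Initials U) (AW : All Initials W) (AV : All Finals V)
  (sub : (fromList C ∪ ⋃ U) ⊆ ⋂ W) (dis : Disjoint (fromList C ∪ ⋃ U) (fromList D ∪ ⋃ V))
  where

  Must May : Subset Node
  Must = fromList C ∪ ⋃ U
  May = ⋂ W ∩ ∁ (fromList D ∪ ⋃ V)

  Low⊆*May : Low ⊆* May
  Low⊆*May = ⊆*-∩ (⊆*-⋂ (All.map proj₁ AW))
                    (⊆*-∁ (∪-⊆* (fromList-⊆* D) (⋃-⊆* (All.map Finals⇒⊆*∁Low AV))))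

  Must⊆*∁High : Must ⊆* ∁ High
  Must⊆*∁High = ∪-⊆* (fromList-⊆* C) (⋃-⊆* (All.map (proj₁ ∘ proj₂) AU))

  Forced Forbidden : Subset Node
  Forced x    = Low x × x ∉ proj₁ Low⊆*May
  Forbidden x = High x × x ∉ proj₁ Must⊆*∁High

  Forced? : Decidable Forced
  Forced? x = (x ≺? [ false ]) ×-dec ¬? (x ∈? proj₁ Low⊆*May)

  CodesOf : Codes → Set
  CodesOf cs = Zip Coded U (codesU cs) × Zip Coded W (codesW cs) × Zip (Coded ∘ Mirror.image) V (codesV cs)

  CodesOf-unique : ∀ {cs cs′} → CodesOf cs → CodesOf cs′ → cs ≡ cs′
  CodesOf-unique (u , w , v) (u′ , w′ , v′)
    with refl ← Zip-unique Coded-unique u u′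
       | refl ← Zip-unique Coded-unique w w′
       | refl ← Zip-unique Coded-unique v v′ = refl

  ¬¬-CodesOf : ¬ ¬ ∃ CodesOf
  ¬¬-CodesOf = do
    cu , u ← ¬¬-Zip (All.map (proj₂ ∘ proj₂) AU)
    cw , w ← ¬¬-Zip (All.map (proj₂ ∘ proj₂) AW)
    cv , v ← ¬¬-Zip (All.map (proj₂ ∘ proj₂) AV)
    pure (codes cu cw cv , u , w , v)

  module _ (cs : Codes) where

    lo hi ν : Node
    lo = cut (argmax cut floor-code (codesU cs))
    hi = cut (argmin cut ceiling-code (codesW cs))
    ν = between lo hi

    Must′ May′ : Subset Node
    Must′ = fromList C ∪ ⋃ (map ⟦_⟧ (codesU cs))
    May′  = ⋂ (map ⟦_⟧ (codesW cs)) ∩ ∁ (fromList D ∪ ⋃ (map (Mirror.preimage ∘ ⟦_⟧) (codesV cs)))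

    Must′? : Decidable Must′
    Must′? x = (x ∈? C) ⊎-dec ⋃? (All.map⁺ (All.universal ⟦_⟧? (codesU cs))) x

    May′? : Decidable May′
    May′? x = ⋂? (All.map⁺ (All.universal ⟦_⟧? (codesW cs))) x ×-dec
              ¬? ((x ∈? D) ⊎-dec ⋃? (All.map⁺ (All.universal (λ c → ⟦ c ⟧? ∘ mirror) (codesV cs))) x)

    Ex : List Node
    Ex = C ++ D ++ keysOf (codesU cs) ++ keysOf (codesW cs) ++ map mirror (keysOf (codesV cs))

    record Outside (x : Node) : Set where
      field
        ∉C : x ∉ C
        ∉D : x ∉ D
        ∉U : All (λ c → x ∉ keys (table c)) (codesU cs)
        ∉W : All (λ c → x ∉ keys (table c)) (codesW cs)
        ∉V : All (λ c → mirror x ∉ keys (table c)) (codesV cs)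

    off-Ex : ∀ {x} → x ∉ Ex → Outside x
    off-Ex {x} x∉ =
      let x∉C , x∉₁ = ∉-++⁻ C x∉
          x∉D , x∉₂ = ∉-++⁻ D x∉₁
          x∉U , x∉₃ = ∉-++⁻ (keysOf (codesU cs)) x∉₂
          x∉W , x∉V = ∉-++⁻ (keysOf (codesW cs)) x∉₃
      in record { ∉C = x∉C ; ∉D = x∉D ; ∉U = ∉-keysOf x∉U ; ∉W = ∉-keysOf x∉W ; ∉V = ∉-keysOf (x∉V ∘ mirror-∈) }
      where
      mirror-∈ : ∀ {K} → mirror x ∈ K → x ∈ map mirror K
      mirror-∈ {K} mx∈ = subst (_∈ map mirror K) (mirror-involutive x) (∈-map⁺ mirror mx∈)

    depth : ℕ
    depth = suc (sum (map length Ex))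

    target? : ∀ x → Dec (Must′ x ⊎ (Forced x × May′ x))
    target? x = Must′? x ⊎-dec (Forced? x ×-dec May′? x)

    -- At a table key the Intended part of Z is ⟦ Zcode ⟧ itself, so the entry is computed from the rest.
    target : Node → Bool
    target = isYes ∘ target?

    Ztable : List Bool → Table
    Ztable bs = graph target Ex ++ diagonal ν depth bs

    Zcode : List Bool → Code
    Zcode bs = code (ν ++ reverse (encode (Ztable bs))) (Ztable bs)

  module WithCodes {cs : Codes} (coded : CodesOf cs) where

    ⋃U≐ : ⋃ U ≐ ⋃ (map ⟦_⟧ (codesU cs))
    ⋃U≐ = ⋃-cong (Zip-≐-map proj₂ (proj₁ coded))

    ⋂W≐ : ⋂ W ≐ ⋂ (map ⟦_⟧ (codesW cs))
    ⋂W≐ = ⋂-cong (Zip-≐-map proj₂ (proj₁ (proj₂ coded)))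

    ⋃V≐ : ⋃ V ≐ ⋃ (map (Mirror.preimage ∘ ⟦_⟧) (codesV cs))
    ⋃V≐ = ⋃-cong (Zip-≐-map (Mirror.image-≐⇒ ∘ proj₂) (proj₂ (proj₂ coded)))

    Must≐Must′ : Must ≐ Must′ cs
    Must≐Must′ = ∪-≐ ≐-refl ⋃U≐

    May≐May′ : May ≐ May′ cs
    May≐May′ = ∩-≐ ⋂W≐ (∁-≐ (∪-≐ ≐-refl ⋃V≐))

    good-U : All Good (codesU cs)
    good-U = Zip-All proj₁ (proj₁ coded)

    good-W : All Good (codesW cs)
    good-W = Zip-All proj₁ (proj₁ (proj₂ coded))

    good-V : All Good (codesV cs)
    good-V = Zip-All proj₁ (proj₂ (proj₂ coded))

    floor≼lo : [ false ] ≼ lo cs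
    floor≼lo = f[⊥]≤f[argmax] {f = cut} floor-code (codesU cs)

    hi≼ceiling : hi cs ≼ []
    hi≼ceiling = f[argmin]≤f[⊤] {f = cut} ceiling-code (codesW cs)

    Must-below-lo : ∀ {x} → x ∉ Ex cs → Must x → x ≺ lo cs
    Must-below-lo x∉ (inj₁ x∈C) = ⊥-elim (Outside.∉C (off-Ex cs x∉) x∈C)
    Must-below-lo x∉ (inj₂ x∈U)
      with All.lookupAny (f[xs]≤f[argmax] {f = cut} floor-code (codesU cs))
             (Any⟦⟧⇒Any≺cut (Outside.∉U (off-Ex cs x∉)) (Equivalence.to ⋃-map⇔Any (proj₁ ⋃U≐ x∈U)))
    ... | c≼lo , x≺c = ≺-≼-trans x≺c c≼lo

    below-hi⇒¬High : ∀ {x} → x ≺ hi cs → ¬ High x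
    below-hi⇒¬High x≺hi = ≺-asym (≺-≼-trans x≺hi hi≼ceiling)

    below-hi⇒May : ∀ {x} → x ∉ Ex cs → x ≺ hi cs → May x
    below-hi⇒May {x} x∉ x≺hi = proj₂ ⋂W≐ (Equivalence.from ⋂-map⇔All in-W) , not-in-DV
      where
      in-W : All (λ c → ⟦ c ⟧ x) (codesW cs)
      in-W = All≺cut⇒All⟦⟧ (Outside.∉W (off-Ex cs x∉))
                            (All.map (≺-≼-trans x≺hi) (f[argmin]≤f[xs] {f = cut} ceiling-code (codesW cs)))
      not-in-DV : ¬ (fromList D ∪ ⋃ V) x
      not-in-DV (inj₁ x∈D) = Outside.∉D (off-Ex cs x∉) x∈D
      not-in-DV (inj₂ x∈V)
        with All.lookupAny good-V
               (Any⟦⟧⇒Any≺cut (Outside.∉V (off-Ex cs x∉)) (Equivalence.to ⋃-map⇔Any (proj₁ ⋃V≐ x∈V)))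
      ... | (_ , _ , c≺root) , mx≺c =
        below-hi⇒¬High x≺hi (subst High (mirror-involutive x) (mirror-≺ (≺-trans mx≺c c≺root)))

    collapse : ¬ lo cs ≺ hi cs → ∃[ A ] ∃[ B ] A ∈ U × B ∈ W × A ≐ B × ∃ (Coded A)
    collapse lo⊀hi =
      let A , A∈ , A-coded = Zip-∈ʳ (proj₁ coded) cA∈
          B , B∈ , B-coded = Zip-∈ʳ (proj₁ (proj₂ coded)) cB∈
          A≐B = ≐-trans (proj₂ A-coded) (subst (λ c → ⟦ c ⟧ ≐ B) (sym cA≡cB) (≐-sym (proj₂ B-coded)))
      in A , B , A∈ , B∈ , A≐B , cA , A-coded
      where
      cA cB : Code
      cA = argmax cut floor-code (codesU cs)
      cB = argmin cut ceiling-code (codesW cs)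
      cA∈ : cA ∈ codesU cs
      cA∈ with argmax-sel cut floor-code (codesU cs)
      ... | inj₂ cA∈′ = cA∈′
      ... | inj₁ cA≡floor = ⊥-elim (lo⊀hi (subst (λ c → cut c ≺ hi cs) (sym cA≡floor) floor≺hi))
        where
        floor≺hi : [ false ] ≺ hi cs
        floor≺hi = argmin-all cut {P = λ c → [ false ] ≺ cut c} left≺root (All.map (proj₁ ∘ proj₂) good-W)
      cB∈ : cB ∈ codesW cs
      cB∈ with argmin-sel cut ceiling-code (codesW cs)
      ... | inj₂ cB∈′ = cB∈′
      ... | inj₁ cB≡ceiling = ⊥-elim (lo⊀hi (subst (λ c → lo cs ≺ cut c) (sym cB≡ceiling) lo≺ceiling))
        where
        lo≺ceiling : lo cs ≺ []
        lo≺ceiling = argmax-all cut {P = λ c → cut c ≺ []} left≺root (All.map (proj₂ ∘ proj₂) good-U)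
      cA⊆cB : ⟦ cA ⟧ ⊆ ⟦ cB ⟧
      cA⊆cB x∈ = All.lookup (Equivalence.to ⋂-map⇔All
                   (proj₁ ⋂W≐ (sub (inj₂ (proj₂ ⋃U≐ (Equivalence.from ⋃-map⇔Any (lose cA∈ x∈))))))) cB∈
      same-cut : cut cA ≡ cut cB
      same-cut with cut-mono {cA} {cB} cA⊆cB
      ... | inj₁ cA≺cB = ⊥-elim (lo⊀hi cA≺cB)
      ... | inj₂ cA≡cB = cA≡cB
      cA≡cB : cA ≡ cB
      cA≡cB = valid-cut-injective (proj₁ (All.lookup good-U cA∈)) (proj₁ (All.lookup good-W cB∈)) same-cut

  Datum : Set
  Datum = Codes × List Bool

  Admissible : List (Subset Node) → Datum → Set
  Admissible Ys (cs , bs) = CodesOf cs × Diagonalises (ν cs) (depth cs) Ys bs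

  Admissible-unique : ∀ {Ys d d′} → Admissible Ys d → Admissible Ys d′ → d ≡ d′
  Admissible-unique (coded , diag) (coded′ , diag′) with refl ← CodesOf-unique coded coded′ =
    cong (_ ,_) (Diagonalises-unique diag diag′)

  ¬¬-Admissible : ∀ Ys → ¬ ¬ ∃ (Admissible Ys)
  ¬¬-Admissible Ys = do
    cs , coded ← ¬¬-CodesOf
    bs , diag  ← ¬¬-Diagonalises (ν cs) (depth cs) Ys
    pure ((cs , bs) , coded , diag)

  -- As the admissible datum is unique, this is the set of the code of Z, though no datum is chosen.
  Intended : List (Subset Node) → Subset Node
  Intended Ys = Chosen (Admissible Ys) (⟦_⟧ ∘ uncurry Zcode)

  -- Forced and Forbidden make Low ⊆* Z ⊆* ∁ High hold without the codes.
  Z : List (Subset Node) → Subset Node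
  Z Ys = Must ∪ ((Forced ∪ (∁ Forbidden ∩ Intended Ys)) ∩ May)

  module _ (Ys : List (Subset Node)) where

    Z⊆May : Z Ys ⊆ May
    Z⊆May (inj₁ l)       = sub l , dis _ l
    Z⊆May (inj₂ (_ , u)) = u

    Low⊆*Z : Low ⊆* Z Ys
    Low⊆*Z = proj₁ Low⊆*May , λ x∉ low → inj₂ (inj₁ (low , x∉) , proj₂ Low⊆*May x∉ low)

    Z⊆*∁High : Z Ys ⊆* ∁ High
    Z⊆*∁High = proj₁ Must⊆*∁High , not-high
      where
      not-high : ∀ {x} → x ∉ proj₁ Must⊆*∁High → Z Ys x → ¬ High x
      not-high x∉ (inj₁ l)                               = proj₂ Must⊆*∁High x∉ l
      not-high x∉ (inj₂ (inj₁ (low , _) , _))            = Low∩High-empty low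
      not-high x∉ (inj₂ (inj₂ (not-forbidden , _) , _)) high = not-forbidden (high , x∉)

    squeeze : ∀ {A B} → A ∈ U → B ∈ W → A ≐ B → Z Ys ≐ A
    squeeze A∈ B∈ A≐B = (λ z → proj₂ A≐B (⋂-∈ B∈ (proj₁ (Z⊆May z)))) , (λ a → inj₁ (inj₂ (⋃-∈ A∈ a)))

  module Gap {Ys cs bs} (adm : Admissible Ys (cs , bs)) (lo≺hi : lo cs ≺ hi cs) where

    open WithCodes (proj₁ adm)

    z tail : Code
    z    = Zcode cs bs
    tail = code (cut z) (diagonal (ν cs) (depth cs) bs)

    cut-between : lo cs ≺ cut z × cut z ≺ hi cs
    cut-between = between-≺ lo≺hi _

    Zcode-good : Good z
    Zcode-good = (ν cs , refl) ,
                 ≼-≺-trans floor≼lo (proj₁ cut-between) , ≺-≼-trans (proj₂ cut-between) hi≼ceiling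

    tail-sandwich : ∀ x → (x ≺ lo cs → ⟦ tail ⟧ x) × (⟦ tail ⟧ x → x ≺ hi cs)
    tail-sandwich = ⟦⟧-sandwich tail (proj₁ cut-between) (proj₂ cut-between)
                      (diagonal-keys (between-≺ lo≺hi) (depth cs) bs)

    lookup-Ztable : ∀ x → lookup (table z) x ≡ (lookup (graph (target cs) (Ex cs)) x <∣> lookup (table tail) x)
    lookup-Ztable = lookup-++ (graph (target cs) (Ex cs)) (table tail)

    Zcode-off-Ex : ∀ {x} → x ∉ Ex cs → ⟦ z ⟧ x ⇔ ⟦ tail ⟧ x
    Zcode-off-Ex {x} x∉ =
      ⟦⟧-lookup {z} (trans (lookup-Ztable x) (cong (_<∣> lookup (table tail) x) (lookup-graph-∉ x∉)))

    Zcode-on-Ex : ∀ {x} → x ∈ Ex cs → ⟦ z ⟧ x ⇔ T (target cs x)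
    Zcode-on-Ex {x} x∈ =
      ⟦⟧-lookup {z} (trans (lookup-Ztable x) (cong (_<∣> lookup (table tail) x) (lookup-graph-∈ x∈)))

    Intended≐Zcode : Intended Ys ≐ ⟦ z ⟧
    Intended≐Zcode = Chosen-≐ (Admissible Ys) (⟦_⟧ ∘ uncurry Zcode) Admissible-unique adm

    Z⊆Zcode : ∀ x → Z Ys x → ⟦ z ⟧ x
    Z⊆Zcode x x∈Z with x ∈? Ex cs | x∈Z
    ... | _      | inj₂ (inj₂ (_ , i) , _) = proj₁ Intended≐Zcode i
    ... | yes x∈ | inj₁ l =
      Equivalence.from (Zcode-on-Ex x∈) (fromWitness (inj₁ (proj₁ Must≐Must′ l)))
    ... | yes x∈ | inj₂ (inj₁ forced , u) =
      Equivalence.from (Zcode-on-Ex x∈) (fromWitness (inj₂ (forced , proj₁ May≐May′ u)))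
    ... | no x∉  | inj₁ l =
      Equivalence.from (Zcode-off-Ex x∉) (proj₁ (tail-sandwich x) (Must-below-lo x∉ l))
    ... | no x∉  | inj₂ (inj₁ (low , _) , _) =
      Equivalence.from (Zcode-off-Ex x∉) (proj₁ (tail-sandwich x) (≺-≼-trans low floor≼lo))

    Zcode⊆Z : ∀ x → ⟦ z ⟧ x → Z Ys x
    Zcode⊆Z x x∈z with x ∈? Ex cs
    ... | yes x∈ with toWitness {a? = target? cs x} (Equivalence.to (Zcode-on-Ex x∈) x∈z)
    ...   | inj₁ l′           = inj₁ (proj₂ Must≐Must′ l′)
    ...   | inj₂ (forced , u′) = inj₂ (inj₁ forced , proj₂ May≐May′ u′)
    Zcode⊆Z x x∈z | no x∉ =
      inj₂ (inj₂ (below-hi⇒¬High x≺hi ∘ proj₁ , proj₂ Intended≐Zcode x∈z) , below-hi⇒May x∉ x≺hi)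
      where
      x≺hi : x ≺ hi cs
      x≺hi = proj₂ (tail-sandwich x) (Equivalence.to (Zcode-off-Ex x∉) x∈z)

    Z≐Zcode : Z Ys ≐ ⟦ z ⟧
    Z≐Zcode = (λ {x} → Z⊆Zcode x) , (λ {x} → Zcode⊆Z x)

    diagonal-new : ∀ {Y} → Y ∈ Ys → ¬ Z Ys ≐ Y
    diagonal-new Y∈ (Z⊆Y , Y⊆Z) with diagonal-witness (proj₂ adm) Y∈
    ... | p , b , deep , found , opposes = Opposes-⇎ opposes Z⇔b (mk⇔ Z⊆Y Y⊆Z)
      where
      p∉ : p ∉ Ex cs
      p∉ = long-∉ (Ex cs) (≤-trans (m≤n+m (depth cs) (length (ν cs))) deep)
      Z⇔b : Z Ys p ⇔ T b
      Z⇔b = ⇔-trans (mk⇔ (Z⊆Zcode p) (Zcode⊆Z p)) (⇔-trans (Zcode-off-Ex p∉) (⟦⟧-lookup {tail} found))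

  Z-coded : ∀ {Ys d} → Admissible Ys d → ∃ (Coded (Z Ys))
  Z-coded {Ys} {cs , bs} adm with lo cs ≺? hi cs
  ... | yes lo≺hi = Zcode cs bs , Zcode-good , Z≐Zcode
    where open Gap adm lo≺hi
  ... | no lo⊀hi with WithCodes.collapse (proj₁ adm) lo⊀hi
  ...   | _ , _ , A∈ , B∈ , A≐B , c , good , A≐c = c , good , ≐-trans (squeeze Ys A∈ B∈ A≐B) A≐c

  Z-new : DisjointFamilies U W → ∀ Ys → All (λ Y → ¬ Z Ys ≐ Y) Ys
  Z-new U#W Ys = All.tabulate λ Y∈ Z≐Y → ¬¬-Admissible Ys λ (_ , adm) → new adm Y∈ Z≐Y
    where
    new : ∀ {d Y} → Admissible Ys d → Y ∈ Ys → ¬ Z Ys ≐ Y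
    new {cs , bs} adm Y∈ with lo cs ≺? hi cs
    ... | yes lo≺hi = Gap.diagonal-new adm lo≺hi Y∈
    ... | no lo⊀hi with WithCodes.collapse (proj₁ adm) lo⊀hi
    ...   | _ , _ , A∈ , B∈ , A≐B , _ = λ _ → All.lookup (All.lookup U#W A∈) B∈ A≐B

  Z-interpolant : ∀ Ys → Interpolant Initials C U W D V (Z Ys)
  Z-interpolant Ys =
    (Low⊆*Z Ys , Z⊆*∁High Ys , ¬¬-map (Z-coded ∘ proj₂) (¬¬-Admissible Ys)) ,
    inj₁ , proj₁ ∘ Z⊆May Ys , λ _ z → proj₂ (Z⊆May Ys z)

condition-i : Cond-i Initials Finals
condition-i U W V C D AU AW AV sub dis =
  (Z [] , Z-interpolant []) , λ U#W Ys → Z Ys , Z-interpolant Ys , Z-new U#W Ys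
  where open Construction U W V C D AU AW AV sub dis

condition-i-mirrored : Cond-i Finals Initials
condition-i-mirrored =
  Cond-i-monoʳ (Initials-extensional (≐-sym (Mirror.image-preimage _)))
    (Mirror.Cond-i⁺ Initials-extensional condition-i)

toℕᵇ : Node → ℕᵇ
toℕᵇ []          = zero
toℕᵇ (false ∷ a) = 1+[2 toℕᵇ a ]
toℕᵇ (true ∷ a)  = 2[1+ toℕᵇ a ]

fromℕᵇ : ℕᵇ → Node
fromℕᵇ zero     = []
fromℕᵇ 1+[2 n ] = false ∷ fromℕᵇ n
fromℕᵇ 2[1+ n ] = true ∷ fromℕᵇ n

toℕᵇ-fromℕᵇ : ∀ n → toℕᵇ (fromℕᵇ n) ≡ n
toℕᵇ-fromℕᵇ zero     = refl
toℕᵇ-fromℕᵇ 1+[2 n ] = cong 1+[2_] (toℕᵇ-fromℕᵇ n)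
toℕᵇ-fromℕᵇ 2[1+ n ] = cong 2[1+_] (toℕᵇ-fromℕᵇ n)

fromℕᵇ-toℕᵇ : ∀ a → fromℕᵇ (toℕᵇ a) ≡ a
fromℕᵇ-toℕᵇ []          = refl
fromℕᵇ-toℕᵇ (false ∷ a) = cong (false ∷_) (fromℕᵇ-toℕᵇ a)
fromℕᵇ-toℕᵇ (true ∷ a)  = cong (true ∷_) (fromℕᵇ-toℕᵇ a)

Node↔ℕ : Node ↔ ℕ
Node↔ℕ = ↔-trans (mk↔ₛ′ toℕᵇ fromℕᵇ toℕᵇ-fromℕᵇ fromℕᵇ-toℕᵇ) (mk↔ ℕᵇ.toℕ-inverseᵇ)

lemma4p2 : (S : Set) → CountablyInfinite S →
    ∃[ Σ₁ ] ∃[ Σ₂ ]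
    ( Extensional {S} Σ₁ × Extensional {S} Σ₂
    × AllMoieties Σ₁ × AllMoieties Σ₂
    × InfiniteFamily Σ₁ × InfiniteFamily Σ₂
    × Cond-i Σ₁ Σ₂ × Cond-ii Σ₁ Σ₂ )
lemma4p2 S S⤖ℕ =
  Initials ⁺ , Finals ⁺ ,
  Extensional⁺ Initials-extensional , Extensional⁺ Finals-extensional ,
  AllMoieties⁺ Initials-moieties , AllMoieties⁺ Finals-moieties ,
  Cond-i⇒InfiniteFamily initials-finals , Cond-i⇒InfiniteFamily finals-initials ,
  initials-finals , Cond-i⇒Cond-ii finals-initials
  where
  open Transport (↔-trans (⤖⇒↔ S⤖ℕ) (↔-sym Node↔ℕ))
  initials-finals : Cond-i (Initials ⁺) (Finals ⁺)
  initials-finals = Cond-i⁺ Initials-extensional condition-i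
  finals-initials : Cond-i (Finals ⁺) (Initials ⁺)
  finals-initials = Cond-i⁺ Finals-extensional condition-i-mirrored
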